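{- Let $G$ be a connected $\mathcal{F}$-free graph without a universal vertex, where $\mathcal{F}=\{P_5,C_5,\mathit{bull},\mathit{banner},\mathit{house},K_{2,3},\overline{P_2\cup P_3}\}$. Assume that $G$ has a minimal connected dominating set $D=\{x,y\}$ of size 2 such that there are private neighbors $x'$ of $x$ and $y'$ of $y$ with respect to $D$ satisfying $x'y'\in E(G)$. Then $G\cong K_{2n}-ne$ for some $n\ge 2$.
   Context: All graphs are finite, simple and undirected. $G$ is $\mathcal{F}$-free if it contains no induced subgraph isomorphic to a member of $\mathcal{F}$. $P_5$, $C_5$: path and cycle on 5 vertices; bull: triangle $abc$ plus vertices $d,e$ with edges $ad,be$; banner: 4-cycle plus a pendant vertex attached to one cycle vertex; house: complement of $P_5$; $K_{2,3}$: complete bipartite graph; $\overline{P_2\cup P_3}$: complement of the disjoint union of paths on 2 and 3 vertices. A universal vertex is adjacent to all other vertices. A connected dominating set is a dominating set inducing a connected subgraph; it is minimal if inclusion-minimal with this property. For $v\in D$, a private neighbor of $v$ with respect to $D$ is a vertex of $N[v]\setminus N[D\setminus\{v\}]$, where $N[\cdot]$ denotes closed neighborhood. For $n\ge2$, $K_{2n}-ne$ is the complete graph on $2n$ vertices minus $n$ pairwise disjoint edges. -}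

module Defs where

open import Data.Nat using (ℕ; zero; suc; _*_; _≤_; _/_)
open import Data.Nat.Properties using () renaming (_≟_ to _≟ℕ_)
open import Data.Fin using (Fin; toℕ; _≟_)
open import Data.Bool using (Bool; true; false; _∧_; _∨_; not)
open import Data.List using (List; []; _∷_)
open import Data.Bool.ListAction using (any)
open import Data.Unit using (⊤)
open import Data.Product using (Σ; ∃; _×_; _,_)
open import Data.Sum using (_⊎_)
open import Relation.Nullary using (¬_; ⌊_⌋)
open import Relation.Binary.PropositionalEquality using (_≡_; _≢_)

record Graph : Set where
  field
    size    : ℕ
    adj     : Fin size → Fin size → Bool
    sym     : ∀ u v → adj u v ≡ adj v u
    irrefl  : ∀ v → adj v v ≡ false
open Graph public

V : Graph → Set
V G = Fin (size G)

Edge : (G : Graph) → V G → V G → Set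
Edge G u v = adj G u v ≡ true

fromEdges : (k : ℕ) → List (ℕ × ℕ) → Fin k → Fin k → Bool
fromEdges k es i j = any (λ { (a , b) →
    (⌊ toℕ i ≟ℕ a ⌋ ∧ ⌊ toℕ j ≟ℕ b ⌋) ∨ (⌊ toℕ i ≟ℕ b ⌋ ∧ ⌊ toℕ j ≟ℕ a ⌋) }) es

P5 : Fin 5 → Fin 5 → Bool
P5 = fromEdges 5 ((0 , 1) ∷ (1 , 2) ∷ (2 , 3) ∷ (3 , 4) ∷ [])

C5 : Fin 5 → Fin 5 → Bool
C5 = fromEdges 5 ((0 , 1) ∷ (1 , 2) ∷ (2 , 3) ∷ (3 , 4) ∷ (4 , 0) ∷ [])

Bull : Fin 5 → Fin 5 → Bool
Bull = fromEdges 5 ((0 , 1) ∷ (1 , 2) ∷ (0 , 2) ∷ (0 , 3) ∷ (1 , 4) ∷ [])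

Banner : Fin 5 → Fin 5 → Bool
Banner = fromEdges 5 ((0 , 1) ∷ (1 , 2) ∷ (2 , 3) ∷ (3 , 0) ∷ (0 , 4) ∷ [])

-- house : complement of the path 0-1-2-3-4
House : Fin 5 → Fin 5 → Bool
House = fromEdges 5 ((0 , 2) ∷ (0 , 3) ∷ (0 , 4) ∷ (1 , 3) ∷ (1 , 4) ∷ (2 , 4) ∷ [])

K23 : Fin 5 → Fin 5 → Bool
K23 = fromEdges 5 ((0 , 2) ∷ (0 , 3) ∷ (0 , 4) ∷ (1 , 2) ∷ (1 , 3) ∷ (1 , 4) ∷ [])

-- complement of P2 ∪ P3, where P2 = 0-1 and P3 = 2-3-4
coP2P3 : Fin 5 → Fin 5 → Bool
coP2P3 = fromEdges 5 ((0 , 2) ∷ (0 , 3) ∷ (0 , 4) ∷ (1 , 2) ∷ (1 , 3) ∷ (1 , 4) ∷ (2 , 4) ∷ [])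

HasInduced : (G : Graph) {k : ℕ} → (Fin k → Fin k → Bool) → Set
HasInduced G {k} H =
  Σ (Fin k → V G) λ f →
    (∀ i j → f i ≡ f j → i ≡ j) × (∀ i j → adj G (f i) (f j) ≡ H i j)

FFree : Graph → Set
FFree G = ¬ HasInduced G P5 × ¬ HasInduced G C5 × ¬ HasInduced G Bull
        × ¬ HasInduced G Banner × ¬ HasInduced G House × ¬ HasInduced G K23
        × ¬ HasInduced G coP2P3

VSet : Graph → Set
VSet G = V G → Bool

data WalkIn (G : Graph) (S : VSet G) : V G → V G → Set where
  here  : ∀ {u} → S u ≡ true → WalkIn G S u u
  step  : ∀ {u w v} → S u ≡ true → Edge G u w → WalkIn G S w v → WalkIn G S u v

InducesConnected : (G : Graph) → VSet G → Set
InducesConnected G S = ∀ u v → S u ≡ true → S v ≡ true → WalkIn G S u v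

full : (G : Graph) → VSet G
full G _ = true

Connected : Graph → Set
Connected G = Σ (V G) (λ _ → ⊤) × InducesConnected G (full G)

InClosedNbhd : (G : Graph) → VSet G → V G → Set
InClosedNbhd G S v = Σ (V G) λ u → S u ≡ true × (u ≡ v ⊎ Edge G u v)

Dominating : (G : Graph) → VSet G → Set
Dominating G S = ∀ v → InClosedNbhd G S v

ConnectedDominating : (G : Graph) → VSet G → Set
ConnectedDominating G S = Dominating G S × InducesConnected G S

Subset : (G : Graph) → VSet G → VSet G → Set
Subset G S T = ∀ (v : V G) → S v ≡ true → T v ≡ true

MinimalConnectedDominating : (G : Graph) → VSet G → Set
MinimalConnectedDominating G S =
  ConnectedDominating G S ×
  (∀ T → Subset G T S → ConnectedDominating G T → Subset G S T)

pair : (G : Graph) → V G → V G → VSet G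
pair G x y v = ⌊ v ≟ x ⌋ ∨ ⌊ v ≟ y ⌋

remove : (G : Graph) → VSet G → V G → VSet G
remove G D v u = D u ∧ not ⌊ u ≟ v ⌋

PrivateNeighbor : (G : Graph) → VSet G → V G → V G → Set
PrivateNeighbor G D v p =
  (p ≡ v ⊎ Edge G v p) × ¬ InClosedNbhd G (remove G D v) p

Universal : (G : Graph) → V G → Set
Universal G v = ∀ u → u ≢ v → Edge G v u

-- K_{2n} - ne : complete graph on {0,…,2n-1} minus the perfect matching
-- {0,1}, {2,3}, …, {2n-2, 2n-1}.

KminusMatching : (n : ℕ) → Fin (2 * n) → Fin (2 * n) → Bool
KminusMatching n i j = not ⌊ toℕ i / 2 ≟ℕ toℕ j / 2 ⌋

record IsoTo (G : Graph) {m : ℕ} (H : Fin m → Fin m → Bool) : Set where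
  field
    to       : V G → Fin m
    from     : Fin m → V G
    from-to  : ∀ v → from (to v) ≡ v
    to-from  : ∀ i → to (from i) ≡ i
    preserves : ∀ u v → H (to u) (to v) ≡ adj G u v

module Submission where

-- Connectivity of {x, y} gives the edge xy; the private neighbours give
-- edges xx', yy', x'y' and non-edges yx', xy'; {x, y} dominates G.  Excluding a
-- house, a banner, K_{2,3} and co-(P₂ ∪ P₃) we show
--   (1) x' is the only private neighbour of x (symmetrically y' of y),
--   (2) every common neighbour of x and y is adjacent to x' (and y'),
--   (3) hence every vertex has at most one non-neighbour.
-- Without universal vertices each vertex then has exactly one non-neighbour,
-- so non-adjacency is a fixed-point-free involution.  Such an involution of
-- Fin m is conjugate to the matching 0↔1, 2↔3, … of Fin (2n), which makes G
-- isomorphic to K_{2n} − ne; n ≥ 2 because x, y, x' are distinct.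

open import Defs
open import Data.Nat using (ℕ; zero; suc; _*_; _+_; _/_; _≤_; z≤n; s≤s; ⌊_/2⌋)
open import Data.Nat.Properties using (+-suc) renaming (_≟_ to _≟ℕ_; suc-injective to ℕ-suc-injective)
open import Data.Nat.DivMod using (m/n≡1+[m∸n]/n)
open import Data.Fin using (Fin; zero; suc; toℕ; _≟_; cast)
open import Data.Fin.Properties using (suc-injective; toℕ-cast; cast-involutive; any?; all?)
open import Data.Fin.Permutation.Components using (transpose; transpose-inverse)
open import Data.Bool using (Bool; true; false; not)
open import Data.Bool.Properties using () renaming (_≟_ to _≟B_)
open import Data.Product using (Σ; _×_; _,_; proj₁; proj₂)
open import Data.Sum using (_⊎_; inj₁; inj₂)
import Data.Sum as Sum
open import Data.Empty using (⊥; ⊥-elim)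
open import Function using (_∘_)
open import Relation.Nullary using (¬_; Dec; yes; no; ⌊_⌋)
open import Relation.Nullary.Decidable using (¬?; _×-dec_; from-yes)
open import Relation.Binary.PropositionalEquality as Eq
  using (_≡_; _≢_; refl; trans; cong; cong₂; ≢-sym; module ≡-Reasoning)

-- 2n, defined so that dbl (suc n) visibly has two more elements
dbl : ℕ → ℕ
dbl zero    = zero
dbl (suc n) = suc (suc (dbl n))

dbl≡2* : ∀ n → dbl n ≡ 2 * n
dbl≡2* zero    = refl
dbl≡2* (suc n) = cong suc (trans (cong suc (dbl≡2* n)) (Eq.sym (+-suc n (n + 0))))

mate : ∀ {n} → Fin (dbl n) → Fin (dbl n)
mate {suc n} zero          = suc zero
mate {suc n} (suc zero)    = zero
mate {suc n} (suc (suc i)) = suc (suc (mate i))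

mate-half : ∀ {n} (i : Fin (dbl n)) → ⌊ toℕ (mate i) /2⌋ ≡ ⌊ toℕ i /2⌋
mate-half {suc n} zero          = refl
mate-half {suc n} (suc zero)    = refl
mate-half {suc n} (suc (suc i)) = cong suc (mate-half i)

same-half : ∀ {n} (i j : Fin (dbl n)) → ⌊ toℕ i /2⌋ ≡ ⌊ toℕ j /2⌋ → j ≡ i ⊎ j ≡ mate i
same-half {suc n} zero          zero          _ = inj₁ refl
same-half {suc n} zero          (suc zero)    _ = inj₂ refl
same-half {suc n} (suc zero)    zero          _ = inj₂ refl
same-half {suc n} (suc zero)    (suc zero)    _ = inj₁ refl
same-half {suc n} (suc (suc i)) (suc (suc j)) e =
  Sum.map (cong λ k → suc (suc k)) (cong λ k → suc (suc k)) (same-half i j (ℕ-suc-injective e))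

-- ⌊_/2⌋ agrees with division by 2, which is what KminusMatching uses
⌊n/2⌋≡n/2 : ∀ m → ⌊ m /2⌋ ≡ m / 2
⌊n/2⌋≡n/2 zero          = refl
⌊n/2⌋≡n/2 (suc zero)    = refl
⌊n/2⌋≡n/2 (suc (suc m)) =
  trans (cong suc (⌊n/2⌋≡n/2 m)) (Eq.sym (m/n≡1+[m∸n]/n {suc (suc m)} {2} (s≤s (s≤s z≤n))))

-- Every fixed-point-free involution of Fin m is conjugate to mate

Involution : {A : Set} → (A → A) → Set
Involution p = ∀ v → p (p v) ≡ v

FixedPointFree : {A : Set} → (A → A) → Set
FixedPointFree p = ∀ v → p v ≢ v

record Conjugate {m : ℕ} (p : Fin m → Fin m) : Set where
  field
    n       : ℕ
    to      : Fin m → Fin (dbl n)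
    from    : Fin (dbl n) → Fin m
    from-to : ∀ v → from (to v) ≡ v
    to-from : ∀ i → to (from i) ≡ i
    to-p    : ∀ v → to (p v) ≡ mate (to v)

conjugate-along : ∀ {m} {p q : Fin m → Fin m} (σ σ⁻¹ : Fin m → Fin m)
  → (∀ v → σ⁻¹ (σ v) ≡ v) → (∀ v → σ (σ⁻¹ v) ≡ v) → (∀ v → σ (p v) ≡ q (σ v))
  → Conjugate q → Conjugate p
conjugate-along σ σ⁻¹ σ⁻¹σ σσ⁻¹ σp C = record
  { n       = n
  ; to      = to ∘ σ
  ; from    = σ⁻¹ ∘ from
  ; from-to = λ v → trans (cong σ⁻¹ (from-to (σ v))) (σ⁻¹σ v)
  ; to-from = λ i → trans (cong to (σσ⁻¹ (from i))) (to-from i)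
  ; to-p    = λ v → trans (cong to (σp v)) (to-p (σ v))
  }
  where open Conjugate C

conjugate-extend : ∀ {k} {q : Fin (suc (suc k)) → Fin (suc (suc k))} {r : Fin k → Fin k}
  → q zero ≡ suc zero → q (suc zero) ≡ zero → (∀ i → q (suc (suc i)) ≡ suc (suc (r i)))
  → Conjugate r → Conjugate q
conjugate-extend {k} {q} q0 q1 q-rest C = record
  { n = suc n ; to = to₂ ; from = from₂ ; from-to = from-to₂ ; to-from = to-from₂ ; to-p = to-q }
  where
  open Conjugate C
  to₂ : Fin (suc (suc k)) → Fin (dbl (suc n))
  to₂ zero          = zero
  to₂ (suc zero)    = suc zero
  to₂ (suc (suc i)) = suc (suc (to i))
  from₂ : Fin (dbl (suc n)) → Fin (suc (suc k))
  from₂ zero          = zero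
  from₂ (suc zero)    = suc zero
  from₂ (suc (suc i)) = suc (suc (from i))
  from-to₂ : ∀ v → from₂ (to₂ v) ≡ v
  from-to₂ zero          = refl
  from-to₂ (suc zero)    = refl
  from-to₂ (suc (suc i)) = cong (λ j → suc (suc j)) (from-to i)
  to-from₂ : ∀ i → to₂ (from₂ i) ≡ i
  to-from₂ zero          = refl
  to-from₂ (suc zero)    = refl
  to-from₂ (suc (suc i)) = cong (λ j → suc (suc j)) (to-from i)
  to-q : ∀ v → to₂ (q v) ≡ mate (to₂ v)
  to-q zero          = cong to₂ q0
  to-q (suc zero)    = cong to₂ q1
  to-q (suc (suc i)) = trans (cong to₂ (q-rest i)) (cong (λ j → suc (suc j)) (to-p i))

module Restrict {k} (q : Fin (suc (suc k)) → Fin (suc (suc k)))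
  (q-inv : Involution q) (q-fpf : FixedPointFree q) (q0 : q zero ≡ suc zero) where

  q1 : q (suc zero) ≡ zero
  q1 = trans (cong q (Eq.sym q0)) (q-inv zero)

  -- drop the two smallest elements (d is a dummy value for 0 and 1)
  drop₂ : Fin k → Fin (suc (suc k)) → Fin k
  drop₂ d (suc (suc j)) = j
  drop₂ d _             = d

  r : Fin k → Fin k
  r i = drop₂ i (q (suc (suc i)))

  q-rest : ∀ i → q (suc (suc i)) ≡ suc (suc (r i))
  q-rest i with q (suc (suc i)) in e
  ... | zero          with () ← trans (Eq.sym (q-inv _)) (trans (cong q e) q0)
  ... | suc zero      with () ← trans (Eq.sym (q-inv _)) (trans (cong q e) q1)
  ... | suc (suc j)   = refl

  r-inv : Involution r
  r-inv i = suc-injective (suc-injective (begin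
    suc (suc (r (r i)))  ≡⟨ Eq.sym (q-rest (r i)) ⟩
    q (suc (suc (r i)))  ≡⟨ cong q (Eq.sym (q-rest i)) ⟩
    q (q (suc (suc i)))  ≡⟨ q-inv _ ⟩
    suc (suc i)          ∎))
    where open ≡-Reasoning

  r-fpf : FixedPointFree r
  r-fpf i e = q-fpf (suc (suc i)) (trans (q-rest i) (cong (λ j → suc (suc j)) e))

transpose-source : ∀ {m} (i j : Fin m) → transpose i j i ≡ j
transpose-source i j with i ≟ i
... | yes _   = refl
... | no i≢i  = ⊥-elim (i≢i refl)

transpose-other : ∀ {m} (i j l : Fin m) → l ≢ i → l ≢ j → transpose i j l ≡ l
transpose-other i j l l≢i l≢j with l ≟ i
... | yes l≡i = ⊥-elim (l≢i l≡i)
... | no _ with l ≟ j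
...   | yes l≡j = ⊥-elim (l≢j l≡j)
...   | no _    = refl

-- conjugating p by the transposition (p 0, 1) makes it swap 0 and 1
module Normalise {k} (p : Fin (suc (suc k)) → Fin (suc (suc k)))
  (p-inv : Involution p) (p-fpf : FixedPointFree p) where

  σ σ⁻¹ q : Fin (suc (suc k)) → Fin (suc (suc k))
  σ   = transpose (p zero) (suc zero)
  σ⁻¹ = transpose (suc zero) (p zero)
  q   = σ ∘ p ∘ σ⁻¹

  σ⁻¹σ : ∀ v → σ⁻¹ (σ v) ≡ v
  σ⁻¹σ v = transpose-inverse (suc zero) (p zero)

  σσ⁻¹ : ∀ v → σ (σ⁻¹ v) ≡ v
  σσ⁻¹ v = transpose-inverse (p zero) (suc zero)

  σp : ∀ v → σ (p v) ≡ q (σ v)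
  σp v = cong (σ ∘ p) (Eq.sym (σ⁻¹σ v))

  q-inv : Involution q
  q-inv v = trans (cong (σ ∘ p) (σ⁻¹σ (p (σ⁻¹ v)))) (trans (cong σ (p-inv (σ⁻¹ v))) (σσ⁻¹ v))

  q-fpf : FixedPointFree q
  q-fpf v e = p-fpf (σ⁻¹ v) (trans (Eq.sym (σ⁻¹σ (p (σ⁻¹ v)))) (cong σ⁻¹ e))

  q0 : q zero ≡ suc zero
  q0 = trans (cong (σ ∘ p) σ⁻¹0) (transpose-source (p zero) (suc zero))
    where
    σ⁻¹0 : σ⁻¹ zero ≡ zero
    σ⁻¹0 = transpose-other (suc zero) (p zero) zero (λ ()) (λ e → p-fpf zero (Eq.sym e))

involution-conjugate : ∀ m (p : Fin m → Fin m) → Involution p → FixedPointFree p → Conjugate p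
involution-conjugate zero p _ _ = record
  { n = zero ; to = λ () ; from = λ () ; from-to = λ () ; to-from = λ () ; to-p = λ () }
involution-conjugate (suc zero) p _ p-fpf with p zero | p-fpf zero
... | zero | p0≢0 = ⊥-elim (p0≢0 refl)
involution-conjugate (suc (suc k)) p p-inv p-fpf =
  conjugate-along {q = q} σ σ⁻¹ σ⁻¹σ σσ⁻¹ σp
    (conjugate-extend {r = r} q0 q1 q-rest (involution-conjugate k r r-inv r-fpf))
  where
  open Normalise p p-inv p-fpf
  open Restrict q q-inv q-fpf q0

-- Graphs in which every vertex has exactly one non-neighbour

NonEdge : (G : Graph) → V G → V G → Set
NonEdge G u v = adj G u v ≡ false

NonNeighbour : (G : Graph) → V G → V G → Set
NonNeighbour G v u = u ≢ v × NonEdge G v u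

module _ (G : Graph) where

  adj-sym : ∀ {u v b} → adj G u v ≡ b → adj G v u ≡ b
  adj-sym {u} {v} e = trans (sym G v u) e

  non-neighbour : ∀ v → ¬ Universal G v → Σ (V G) (NonNeighbour G v)
  non-neighbour v v-not-universal
    with any? (λ u → ¬? (u ≟ v) ×-dec (adj G v u ≟B false))
  ... | yes found = found
  ... | no none   = ⊥-elim (v-not-universal adjacent)
    where
    adjacent : ∀ u → u ≢ v → Edge G v u
    adjacent u u≢v with adj G v u in e
    ... | true  = refl
    ... | false = ⊥-elim (none (u , u≢v , e))

matching-iso : (G : Graph) (n : ℕ) (to : V G → Fin (dbl n)) (from : Fin (dbl n) → V G)
  → (∀ v → from (to v) ≡ v) → (∀ i → to (from i) ≡ i)
  → (∀ u v → not ⌊ ⌊ toℕ (to u) /2⌋ ≟ℕ ⌊ toℕ (to v) /2⌋ ⌋ ≡ adj G u v)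
  → IsoTo G (KminusMatching n)
matching-iso G n to from from-to to-from adj-half = record
  { to        = cast n≡ ∘ to
  ; from      = from ∘ cast (Eq.sym n≡)
  ; from-to   = λ v → trans (cong from (cast-involutive (Eq.sym n≡) n≡ (to v))) (from-to v)
  ; to-from   = λ i → trans (cong (cast n≡) (to-from (cast (Eq.sym n≡) i)))
                            (cast-involutive n≡ (Eq.sym n≡) i)
  ; preserves = λ u v → trans (cong₂ (λ a b → not ⌊ a ≟ℕ b ⌋) (half u) (half v)) (adj-half u v)
  }
  where
  n≡ = dbl≡2* n
  half : ∀ v → toℕ (cast n≡ (to v)) / 2 ≡ ⌊ toℕ (to v) /2⌋
  half v = trans (cong (_/ 2) (toℕ-cast n≡ (to v))) (Eq.sym (⌊n/2⌋≡n/2 (toℕ (to v))))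

unique-non-neighbour-iso : (G : Graph) (p : V G → V G)
  → (∀ v → NonNeighbour G v (p v)) → (∀ v u → NonNeighbour G v u → u ≡ p v)
  → Σ ℕ λ n → IsoTo G (KminusMatching n)
unique-non-neighbour-iso G p p-non p-unique =
  n , matching-iso G n to from from-to to-from adj-half
  where
  p-fpf : FixedPointFree p
  p-fpf v = proj₁ (p-non v)

  p-inv : Involution p
  p-inv v = Eq.sym (p-unique (p v) v ((λ e → p-fpf v (Eq.sym e)) , adj-sym G (proj₂ (p-non v))))

  open Conjugate (involution-conjugate (size G) p p-inv p-fpf)

  to-injective : ∀ u v → to u ≡ to v → u ≡ v
  to-injective u v e = trans (Eq.sym (from-to u)) (trans (cong from e) (from-to v))

  adj-half : ∀ u v → not ⌊ ⌊ toℕ (to u) /2⌋ ≟ℕ ⌊ toℕ (to v) /2⌋ ⌋ ≡ adj G u v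
  adj-half u v with ⌊ toℕ (to u) /2⌋ ≟ℕ ⌊ toℕ (to v) /2⌋
  ... | yes same with same-half (to u) (to v) same
  ...   | inj₁ v≡u  rewrite to-injective v u v≡u = Eq.sym (irrefl G u)
  ...   | inj₂ v≡pu rewrite to-injective v (p u) (trans v≡pu (Eq.sym (to-p u))) =
            Eq.sym (proj₂ (p-non u))
  adj-half u v | no different with adj G u v in e
  ... | true  = refl
  ... | false with v ≟ u
  ...   | yes refl = ⊥-elim (different refl)
  ...   | no v≢u   = ⊥-elim (different (begin
          ⌊ toℕ (to u) /2⌋        ≡⟨ Eq.sym (mate-half (to u)) ⟩
          ⌊ toℕ (mate (to u)) /2⌋ ≡⟨ cong (λ i → ⌊ toℕ i /2⌋) (Eq.sym (to-p u)) ⟩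
          ⌊ toℕ (to (p u)) /2⌋    ≡⟨ cong (λ w → ⌊ toℕ (to w) /2⌋) (Eq.sym (p-unique u v (v≢u , e))) ⟩
          ⌊ toℕ (to v) /2⌋        ∎))
    where open ≡-Reasoning

AtMostOneNonNeighbour : (G : Graph) → V G → Set
AtMostOneNonNeighbour G v = ∀ u w → NonNeighbour G v u → NonNeighbour G v w → u ≡ w

only⇒at-most-one : ∀ G {v} t → (∀ u → NonNeighbour G v u → u ≡ t) → AtMostOneNonNeighbour G v
only⇒at-most-one G t only u w u-non w-non = trans (only u u-non) (Eq.sym (only w w-non))

co-matching : (G : Graph) → (∀ v → ¬ Universal G v) → (∀ v → AtMostOneNonNeighbour G v)
  → Σ ℕ λ n → IsoTo G (KminusMatching n)
co-matching G no-universal at-most-one =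
  unique-non-neighbour-iso G p (λ v → proj₂ (chosen v))
    (λ v u u-non → at-most-one v u (p v) u-non (proj₂ (chosen v)))
  where
  chosen : ∀ v → Σ (V G) (NonNeighbour G v)
  chosen v = non-neighbour G v (no-universal v)
  p : V G → V G
  p v = proj₁ (chosen v)

three-vertices⇒2≤n : ∀ {G : Graph} (a b c : V G) → a ≢ b → a ≢ c → b ≢ c
  → Σ ℕ (λ n → IsoTo G (KminusMatching n)) → Σ ℕ λ n → 2 ≤ n × IsoTo G (KminusMatching n)
three-vertices⇒2≤n a b c a≢b a≢c b≢c (n , iso) =
  n , three-in-Fin n (to a) (to b) (to c) (distinct a≢b) (distinct a≢c) (distinct b≢c) , iso
  where
  open IsoTo iso
  distinct : ∀ {u v} → u ≢ v → to u ≢ to v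
  distinct {u} {v} u≢v e = u≢v (trans (Eq.sym (from-to u)) (trans (cong from e) (from-to v)))
  three-in-Fin : ∀ m (i j k : Fin (2 * m)) → i ≢ j → i ≢ k → j ≢ k → 2 ≤ m
  three-in-Fin (suc (suc m)) _ _ _ _ _ _ = s≤s (s≤s z≤n)
  three-in-Fin (suc zero) zero zero _ i≢j _ _ = ⊥-elim (i≢j refl)
  three-in-Fin (suc zero) (suc zero) (suc zero) _ i≢j _ _ = ⊥-elim (i≢j refl)
  three-in-Fin (suc zero) zero (suc zero) zero _ i≢k _ = ⊥-elim (i≢k refl)
  three-in-Fin (suc zero) zero (suc zero) (suc zero) _ _ j≢k = ⊥-elim (j≢k refl)
  three-in-Fin (suc zero) (suc zero) zero zero _ _ j≢k = ⊥-elim (j≢k refl)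
  three-in-Fin (suc zero) (suc zero) zero (suc zero) _ i≢k _ = ⊥-elim (i≢k refl)

-- Recognising the forbidden patterns as induced subgraphs

-- A pattern on five vertices: a symmetric, loopless adjacency table.  For the
-- concrete patterns of Defs both properties are decided by evaluation.
Symmetric₅ Loopless₅ : (Fin 5 → Fin 5 → Bool) → Set
Symmetric₅ H = ∀ i j → H i j ≡ H j i
Loopless₅  H = ∀ i → H i i ≡ false

symmetric₅? : ∀ H → Dec (Symmetric₅ H)
symmetric₅? H = all? λ i → all? λ j → H i j ≟B H j i

loopless₅? : ∀ H → Dec (Loopless₅ H)
loopless₅? H = all? λ i → H i i ≟B false

pattern f0 = zero
pattern f1 = suc zero
pattern f2 = suc (suc zero)
pattern f3 = suc (suc (suc zero))
pattern f4 = suc (suc (suc (suc zero)))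

module _ (G : Graph) where

  adjacent⇒distinct : ∀ {u v} → Edge G u v → u ≢ v
  adjacent⇒distinct {u} uv refl with () ← trans (Eq.sym uv) (irrefl G u)

  separated : ∀ {u v w} → Edge G u w → NonEdge G v w → u ≢ v
  separated uw vw refl with () ← trans (Eq.sym uw) vw

  separated′ : ∀ {u v w} → Edge G w u → NonEdge G w v → u ≢ v
  separated′ wu wv = separated (adj-sym G wu) (adj-sym G wv)

  embed₅ : (H : Fin 5 → Fin 5 → Bool) → Symmetric₅ H → Loopless₅ H → (a b c d e : V G)
    → a ≢ b → a ≢ c → a ≢ d → a ≢ e → b ≢ c → b ≢ d → b ≢ e → c ≢ d → c ≢ e → d ≢ e
    → adj G a b ≡ H f0 f1 → adj G a c ≡ H f0 f2
    → adj G a d ≡ H f0 f3 → adj G a e ≡ H f0 f4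
    → adj G b c ≡ H f1 f2 → adj G b d ≡ H f1 f3
    → adj G b e ≡ H f1 f4 → adj G c d ≡ H f2 f3
    → adj G c e ≡ H f2 f4 → adj G d e ≡ H f3 f4
    → HasInduced G (H)
  embed₅ H H-sym H-loopless a b c d e a≢b a≢c a≢d a≢e b≢c b≢d b≢e c≢d c≢e d≢e
         ab ac ad ae bc bd be cd ce de = f , injective , agrees
    where
    f : Fin 5 → V G
    f f0 = a
    f f1 = b
    f f2 = c
    f f3 = d
    f f4 = e
    injective : ∀ i j → f i ≡ f j → i ≡ j
    injective f0 f0 _ = refl
    injective f1 f1 _ = refl
    injective f2 f2 _ = refl
    injective f3 f3 _ = refl
    injective f4 f4 _ = refl
    injective f0 f1 q = ⊥-elim (a≢b q)
    injective f0 f2 q = ⊥-elim (a≢c q)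
    injective f0 f3 q = ⊥-elim (a≢d q)
    injective f0 f4 q = ⊥-elim (a≢e q)
    injective f1 f2 q = ⊥-elim (b≢c q)
    injective f1 f3 q = ⊥-elim (b≢d q)
    injective f1 f4 q = ⊥-elim (b≢e q)
    injective f2 f3 q = ⊥-elim (c≢d q)
    injective f2 f4 q = ⊥-elim (c≢e q)
    injective f3 f4 q = ⊥-elim (d≢e q)
    injective f1 f0 q = ⊥-elim (a≢b (Eq.sym q))
    injective f2 f0 q = ⊥-elim (a≢c (Eq.sym q))
    injective f3 f0 q = ⊥-elim (a≢d (Eq.sym q))
    injective f4 f0 q = ⊥-elim (a≢e (Eq.sym q))
    injective f2 f1 q = ⊥-elim (b≢c (Eq.sym q))
    injective f3 f1 q = ⊥-elim (b≢d (Eq.sym q))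
    injective f4 f1 q = ⊥-elim (b≢e (Eq.sym q))
    injective f3 f2 q = ⊥-elim (c≢d (Eq.sym q))
    injective f4 f2 q = ⊥-elim (c≢e (Eq.sym q))
    injective f4 f3 q = ⊥-elim (d≢e (Eq.sym q))
    upper : ∀ i j → adj G (f i) (f j) ≡ H i j → adj G (f j) (f i) ≡ H j i
    upper i j q = trans (adj-sym G q) (H-sym i j)
    diagonal : ∀ i → adj G (f i) (f i) ≡ H i i
    diagonal i = trans (irrefl G (f i)) (Eq.sym (H-loopless i))
    agrees : ∀ i j → adj G (f i) (f j) ≡ H i j
    agrees f0 f1 = ab
    agrees f0 f2 = ac
    agrees f0 f3 = ad
    agrees f0 f4 = ae
    agrees f1 f2 = bc
    agrees f1 f3 = bd
    agrees f1 f4 = be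
    agrees f2 f3 = cd
    agrees f2 f4 = ce
    agrees f3 f4 = de
    agrees f1 f0 = upper f0 f1 ab
    agrees f2 f0 = upper f0 f2 ac
    agrees f3 f0 = upper f0 f3 ad
    agrees f4 f0 = upper f0 f4 ae
    agrees f2 f1 = upper f1 f2 bc
    agrees f3 f1 = upper f1 f3 bd
    agrees f4 f1 = upper f1 f4 be
    agrees f3 f2 = upper f2 f3 cd
    agrees f4 f2 = upper f2 f4 ce
    agrees f4 f3 = upper f3 f4 de
    agrees f0 f0 = diagonal f0
    agrees f1 f1 = diagonal f1
    agrees f2 f2 = diagonal f2
    agrees f3 f3 = diagonal f3
    agrees f4 f4 = diagonal f4

  -- The four patterns, with vertices a, b, c, d, e in the numbering of their
  -- definitions.  Distinctness is derived from the adjacencies except for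
  -- pairs of non-adjacent twins of the pattern, which must be given.

  house : ∀ a b c d e → NonEdge G a b → Edge G a c → Edge G a d → Edge G a e → NonEdge G b c
    → Edge G b d → Edge G b e → NonEdge G c d → Edge G c e → NonEdge G d e → HasInduced G House
  house a b c d e ab ac ad ae bc bd be cd ce de =
    embed₅ House (from-yes (symmetric₅? House)) (from-yes (loopless₅? House)) a b c d e
      (separated ac bc) (adjacent⇒distinct ac) (adjacent⇒distinct ad) (adjacent⇒distinct ae)
      (separated bd cd) (adjacent⇒distinct bd) (adjacent⇒distinct be)
      (separated ce de) (adjacent⇒distinct ce) (≢-sym (separated (adj-sym G ce) (adj-sym G cd)))
      ab ac ad ae bc bd be cd ce de

  -- banner: 4-cycle a b c d plus pendant e at a; b and d are twins
  banner : ∀ a b c d e → b ≢ d → Edge G a b → NonEdge G a c → Edge G a d → Edge G a e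
    → Edge G b c → NonEdge G b d → NonEdge G b e → Edge G c d → NonEdge G c e → NonEdge G d e
    → HasInduced G Banner
  banner a b c d e b≢d ab ac ad ae bc bd be cd ce de =
    embed₅ Banner (from-yes (symmetric₅? Banner)) (from-yes (loopless₅? Banner)) a b c d e
      (adjacent⇒distinct ab) (separated ae ce) (adjacent⇒distinct ad) (adjacent⇒distinct ae)
      (adjacent⇒distinct bc) b≢d (separated bc (adj-sym G ce))
      (adjacent⇒distinct cd) (separated (adj-sym G bc) (adj-sym G be))
      (separated (adj-sym G cd) (adj-sym G ce))
      ab ac ad ae bc bd be cd ce de

  -- K_{2,3} with parts {a, b} and {c, d, e}; both parts consist of twins
  k23 : ∀ a b c d e → a ≢ b → c ≢ d → c ≢ e → d ≢ e
    → NonEdge G a b → Edge G a c → Edge G a d → Edge G a e → Edge G b c → Edge G b d → Edge G b e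
    → NonEdge G c d → NonEdge G c e → NonEdge G d e → HasInduced G K23
  k23 a b c d e a≢b c≢d c≢e d≢e ab ac ad ae bc bd be cd ce de =
    embed₅ K23 (from-yes (symmetric₅? K23)) (from-yes (loopless₅? K23)) a b c d e
      a≢b (adjacent⇒distinct ac) (adjacent⇒distinct ad) (adjacent⇒distinct ae)
      (adjacent⇒distinct bc) (adjacent⇒distinct bd) (adjacent⇒distinct be) c≢d c≢e d≢e
      ab ac ad ae bc bd be cd ce de

  -- complement of P₂ ∪ P₃ with P₂ = a b and P₃ = c d e; a and b are twins
  co-P₂∪P₃ : ∀ a b c d e → a ≢ b
    → NonEdge G a b → Edge G a c → Edge G a d → Edge G a e → Edge G b c → Edge G b d → Edge G b e
    → NonEdge G c d → Edge G c e → NonEdge G d e → HasInduced G coP2P3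
  co-P₂∪P₃ a b c d e a≢b ab ac ad ae bc bd be cd ce de =
    embed₅ coP2P3 (from-yes (symmetric₅? coP2P3)) (from-yes (loopless₅? coP2P3)) a b c d e
      a≢b (adjacent⇒distinct ac) (adjacent⇒distinct ad) (adjacent⇒distinct ae)
      (adjacent⇒distinct bc) (adjacent⇒distinct bd) (adjacent⇒distinct be)
      (separated ce de) (adjacent⇒distinct ce) (≢-sym (separated (adj-sym G ce) (adj-sym G cd)))
      ab ac ad ae bc bd be cd ce de

record Configuration (G : Graph) : Set where
  field
    x y x' y'   : V G
    x~y         : Edge G x y
    x~x'        : Edge G x x'
    y~y'        : Edge G y y'
    x'~y'       : Edge G x' y'
    y≁x'        : NonEdge G y x'
    x≁y'        : NonEdge G x y'
    x'≢y        : x' ≢ y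
    y'≢x        : y' ≢ x
    dominated   : ∀ v → v ≡ x ⊎ v ≡ y ⊎ Edge G x v ⊎ Edge G y v
    no-banner   : ¬ HasInduced G Banner
    no-house    : ¬ HasInduced G House
    no-K23      : ¬ HasInduced G K23
    no-co-P₂∪P₃ : ¬ HasInduced G coP2P3

mirror : ∀ {G} → Configuration G → Configuration G
mirror {G} C = record
  { x = y ; y = x ; x' = y' ; y' = x'
  ; x~y = adj-sym G x~y ; x~x' = y~y' ; y~y' = x~x' ; x'~y' = adj-sym G x'~y'
  ; y≁x' = x≁y' ; x≁y' = y≁x' ; x'≢y = y'≢x ; y'≢x = x'≢y
  ; dominated = λ v → swap-xy (dominated v)
  ; no-banner = no-banner ; no-house = no-house ; no-K23 = no-K23 ; no-co-P₂∪P₃ = no-co-P₂∪P₃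
  }
  where
  open Configuration C
  swap-xy : ∀ {v} → v ≡ x ⊎ v ≡ y ⊎ Edge G x v ⊎ Edge G y v → v ≡ y ⊎ v ≡ x ⊎ Edge G y v ⊎ Edge G x v
  swap-xy (inj₁ v≡x)                = inj₂ (inj₁ v≡x)
  swap-xy (inj₂ (inj₁ v≡y))         = inj₁ v≡y
  swap-xy (inj₂ (inj₂ (inj₁ x~v)))  = inj₂ (inj₂ (inj₂ x~v))
  swap-xy (inj₂ (inj₂ (inj₂ y~v)))  = inj₂ (inj₂ (inj₁ y~v))

module _ {G : Graph} (C : Configuration G) where
  open Configuration C

  Common : V G → Set
  Common v = Edge G x v × Edge G y v

  -- (1) x' is the only private neighbour of x: any other one would form a
  -- house, a co-(P₂ ∪ P₃), a banner or a K_{2,3} with x, y, x', y'.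
  private-neighbour-unique : ∀ a → Edge G x a → NonEdge G y a → a ≢ y → a ≡ x'
  private-neighbour-unique a x~a y≁a a≢y with a ≟ x'
  ... | yes a≡x' = a≡x'
  ... | no a≢x' with adj G a x' in a?x' | adj G a y' in a?y'
  ... | true  | false = ⊥-elim (no-house (house G x y' a y x'
          x≁y' x~a x~y x~x' (adj-sym G a?y') (adj-sym G y~y') (adj-sym G x'~y')
          (adj-sym G y≁a) a?x' y≁x'))
  ... | true  | true  = ⊥-elim (no-co-P₂∪P₃ (co-P₂∪P₃ G x y' a y x' (≢-sym y'≢x)
          x≁y' x~a x~y x~x' (adj-sym G a?y') (adj-sym G y~y') (adj-sym G x'~y')
          (adj-sym G y≁a) a?x' y≁x'))
  ... | false | false = ⊥-elim (no-banner (banner G x x' y' y a x'≢y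
          x~x' x≁y' x~y x~a x'~y' (adj-sym G y≁x') (adj-sym G a?x')
          (adj-sym G y~y') (adj-sym G a?y') y≁a))
  ... | false | true  = ⊥-elim (no-K23 (k23 G x y' a x' y (≢-sym y'≢x) a≢x' a≢y x'≢y
          x≁y' x~a x~x' x~y (adj-sym G a?y') (adj-sym G x'~y') (adj-sym G y~y')
          a?x' (adj-sym G y≁a) (adj-sym G y≁x')))

  -- (2) every common neighbour c of x and y is adjacent to x', else a house
  -- or a co-(P₂ ∪ P₃) appears on x, y', c, x', y.
  common-sees-x' : ∀ c → Common c → Edge G x' c
  common-sees-x' c (x~c , y~c) with adj G x' c in x'?c
  ... | true  = refl
  ... | false with adj G y' c in y'?c
  ...   | false = ⊥-elim (no-house (house G x y' c x' y
            x≁y' x~c x~x' x~y y'?c (adj-sym G x'~y') (adj-sym G y~y')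
            (adj-sym G x'?c) (adj-sym G y~c) (adj-sym G y≁x')))
  ...   | true  = ⊥-elim (no-co-P₂∪P₃ (co-P₂∪P₃ G x y' y x' c (≢-sym y'≢x)
            x≁y' x~y x~x' x~c (adj-sym G y~y') (adj-sym G x'~y') y'?c y≁x' y~c x'?c))

  -- no common neighbour has two distinct common neighbours as non-neighbours:
  -- with x' and y they would form a K_{2,3} or a co-(P₂ ∪ P₃)
  no-two-common-non-neighbours : ∀ c c₁ c₂ → Common c → Common c₁ → Common c₂
    → c₁ ≢ c₂ → NonNeighbour G c c₁ → NonNeighbour G c c₂ → ⊥
  no-two-common-non-neighbours c c₁ c₂ c-common c₁-common c₂-common c₁≢c₂ (c₁≢c , c≁c₁) (c₂≢c , c≁c₂)
    with adj G c₁ c₂ in c₁?c₂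
  ... | false = no-K23 (k23 G x' y c c₁ c₂ x'≢y (≢-sym c₁≢c) (≢-sym c₂≢c) c₁≢c₂
          (adj-sym G y≁x') (common-sees-x' c c-common) (common-sees-x' c₁ c₁-common)
          (common-sees-x' c₂ c₂-common) (proj₂ c-common) (proj₂ c₁-common) (proj₂ c₂-common)
          c≁c₁ c≁c₂ c₁?c₂)
  ... | true  = no-co-P₂∪P₃ (co-P₂∪P₃ G x' y c₁ c c₂ x'≢y
          (adj-sym G y≁x') (common-sees-x' c₁ c₁-common) (common-sees-x' c c-common)
          (common-sees-x' c₂ c₂-common) (proj₂ c₁-common) (proj₂ c-common) (proj₂ c₂-common)
          (adj-sym G c≁c₁) c₁?c₂ c≁c₂)

  -- a non-neighbour of a common neighbour that is adjacent to x is adjacent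
  -- to y too: otherwise it is x' by (1), which is adjacent to it by (2)
  common-non-neighbour-sees-y : ∀ v u → Common v → NonNeighbour G v u → Edge G x u → Edge G y u
  common-non-neighbour-sees-y v u v-common (_ , v≁u) x~u with adj G y u in y?u
  ... | true  = refl
  ... | false = ⊥-elim (separated′ G (adj-sym G (common-sees-x' v v-common)) v≁u
                  (Eq.sym (private-neighbour-unique u x~u y?u
                    (≢-sym (separated′ G (adj-sym G (proj₂ v-common)) v≁u)))))

module _ {G : Graph} (C : Configuration G) where
  open Configuration C

  common-non-neighbour : ∀ v u → Common C v → NonNeighbour G v u → Common C u
  common-non-neighbour v u v-common@(x~v , y~v) u-non@(_ , v≁u) with dominated u
  ... | inj₁ u≡x               = ⊥-elim (separated′ G (adj-sym G x~v) v≁u (Eq.sym u≡x))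
  ... | inj₂ (inj₁ u≡y)        = ⊥-elim (separated′ G (adj-sym G y~v) v≁u (Eq.sym u≡y))
  ... | inj₂ (inj₂ (inj₁ x~u)) = x~u , common-non-neighbour-sees-y C v u v-common u-non x~u
  ... | inj₂ (inj₂ (inj₂ y~u)) =
    common-non-neighbour-sees-y (mirror C) v u (y~v , x~v) u-non y~u , y~u

  common-at-most-one : ∀ v → Common C v → AtMostOneNonNeighbour G v
  common-at-most-one v v-common u w u-non w-non with u ≟ w
  ... | yes u≡w = u≡w
  ... | no u≢w  = ⊥-elim (no-two-common-non-neighbours C v u w v-common
                    (common-non-neighbour v u v-common u-non)
                    (common-non-neighbour v w v-common w-non) u≢w u-non w-non)

  only-non-neighbour-of-x : ∀ u → NonNeighbour G x u → u ≡ y'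
  only-non-neighbour-of-x u (u≢x , x≁u) with dominated u
  ... | inj₁ u≡x               = ⊥-elim (u≢x u≡x)
  ... | inj₂ (inj₁ u≡y)        = ⊥-elim (separated′ G x~y x≁u (Eq.sym u≡y))
  ... | inj₂ (inj₂ (inj₁ x~u)) = ⊥-elim (separated′ G x~u x≁u refl)
  ... | inj₂ (inj₂ (inj₂ y~u)) = private-neighbour-unique (mirror C) u y~u x≁u u≢x

  only-non-neighbour-of-x' : ∀ u → NonNeighbour G x' u → u ≡ y
  only-non-neighbour-of-x' u (u≢x' , x'≁u) with u ≟ y | dominated u
  ... | yes u≡y | _                         = u≡y
  ... | no _    | inj₁ u≡x                  = ⊥-elim (separated′ G (adj-sym G x~x') x'≁u (Eq.sym u≡x))
  ... | no u≢y  | inj₂ (inj₁ u≡y)           = ⊥-elim (u≢y u≡y)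
  ... | no u≢y  | inj₂ (inj₂ (inj₁ x~u)) with adj G y u in y?u
  ...   | true  = ⊥-elim (separated′ G (common-sees-x' C u (x~u , y?u)) x'≁u refl)
  ...   | false = ⊥-elim (u≢x' (private-neighbour-unique C u x~u y?u u≢y))
  only-non-neighbour-of-x' u (u≢x' , x'≁u) | no u≢y | inj₂ (inj₂ (inj₂ y~u)) with adj G x u in x?u
  ...   | true  = ⊥-elim (separated′ G (common-sees-x' C u (x?u , y~u)) x'≁u refl)
  ...   | false = ⊥-elim (separated′ G x'~y' x'≁u
                    (Eq.sym (private-neighbour-unique (mirror C) u y~u x?u
                      (≢-sym (separated′ G (adj-sym G x~x') x'≁u)))))

  -- a neighbour of x other than y is either a common neighbour or, by (1), x'
  neighbour-of-x-at-most-one : ∀ v → v ≢ y → Edge G x v → AtMostOneNonNeighbour G v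
  neighbour-of-x-at-most-one v v≢y x~v with adj G y v in y?v
  ... | true  = common-at-most-one v (x~v , y?v)
  ... | false = Eq.subst (AtMostOneNonNeighbour G) (Eq.sym (private-neighbour-unique C v x~v y?v v≢y))
                  (only⇒at-most-one G y only-non-neighbour-of-x')

module _ {G : Graph} (C : Configuration G) where
  open Configuration C

  at-most-one-non-neighbour : ∀ v → AtMostOneNonNeighbour G v
  at-most-one-non-neighbour v with v ≟ x | v ≟ y | dominated v
  ... | yes refl | _        | _                      = only⇒at-most-one G y' (only-non-neighbour-of-x C)
  ... | no _     | yes refl | _                      = only⇒at-most-one G x' (only-non-neighbour-of-x (mirror C))
  ... | no v≢x   | no _     | inj₁ v≡x               = ⊥-elim (v≢x v≡x)
  ... | no _     | no v≢y   | inj₂ (inj₁ v≡y)        = ⊥-elim (v≢y v≡y)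
  ... | no _     | no v≢y   | inj₂ (inj₂ (inj₁ x~v)) = neighbour-of-x-at-most-one C v v≢y x~v
  ... | no v≢x   | no _     | inj₂ (inj₂ (inj₂ y~v)) = neighbour-of-x-at-most-one (mirror C) v v≢x y~v

module _ (G : Graph) where

  walk-start : ∀ {S u v} → WalkIn G S u v → S u ≡ true
  walk-start (here u∈S)     = u∈S
  walk-start (step u∈S _ _) = u∈S

  private-distinct : ∀ {D v p z} → PrivateNeighbor G D v p → remove G D v z ≡ true → p ≢ z
  private-distinct (_ , unseen) z∈ p≡z = unseen (_ , z∈ , inj₁ (Eq.sym p≡z))

  private-non-adjacent : ∀ {D v p z} → PrivateNeighbor G D v p → remove G D v z ≡ true → NonEdge G z p
  private-non-adjacent {p = p} {z} (_ , unseen) z∈ with adj G z p in z?p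
  ... | true  = ⊥-elim (unseen (z , z∈ , inj₂ z?p))
  ... | false = refl

  private-adjacent : ∀ {D v p z} → PrivateNeighbor G D v p → remove G D v z ≡ true → Edge G z v
    → Edge G v p
  private-adjacent (inj₂ v~p , _)      _  _   = v~p
  private-adjacent (inj₁ refl , unseen) z∈ z~v = ⊥-elim (unseen (_ , z∈ , inj₂ z~v))

module _ (G : Graph) (x y : V G) (x≢y : x ≢ y) where

  pair-elements : ∀ v → pair G x y v ≡ true → v ≡ x ⊎ v ≡ y
  pair-elements v v∈ with v ≟ x | v ≟ y
  ... | yes v≡x | _       = inj₁ v≡x
  ... | no _    | yes v≡y = inj₂ v≡y
  ... | no _    | no _    with () ← v∈

  x∈pair : pair G x y x ≡ true
  x∈pair with x ≟ x
  ... | yes _   = refl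
  ... | no x≢x  = ⊥-elim (x≢x refl)

  y∈pair : pair G x y y ≡ true
  y∈pair with y ≟ x | y ≟ y
  ... | yes _ | _       = refl
  ... | no _  | yes _   = refl
  ... | no _  | no y≢y  = ⊥-elim (y≢y refl)

  y∈pair-x : remove G (pair G x y) x y ≡ true
  y∈pair-x with y ≟ x | y ≟ y
  ... | yes y≡x | _      = ⊥-elim (x≢y (Eq.sym y≡x))
  ... | no _    | yes _  = refl
  ... | no _    | no y≢y = ⊥-elim (y≢y refl)

  x∈pair-y : remove G (pair G x y) y x ≡ true
  x∈pair-y with x ≟ x | x ≟ y
  ... | _      | yes x≡y = ⊥-elim (x≢y x≡y)
  ... | yes _  | no _    = refl
  ... | no x≢x | no _    = ⊥-elim (x≢x refl)

  -- {x, y} induces a connected subgraph only if xy is an edge: a walk in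
  -- {x, y} leaving x must step to y
  connected-pair-adjacent : InducesConnected G (pair G x y) → Edge G x y
  connected-pair-adjacent connected = leave (connected x y x∈pair y∈pair) x≢y
    where
    leave : ∀ {v} → WalkIn G (pair G x y) x v → x ≢ v → Edge G x y
    leave (here _) x≢v = ⊥-elim (x≢v refl)
    leave (step {w = w} _ x~w rest) _ with pair-elements w (walk-start G rest)
    ... | inj₁ refl = ⊥-elim (adjacent⇒distinct G x~w refl)
    ... | inj₂ refl = x~w

  dominated-by-pair : Dominating G (pair G x y) → ∀ v → v ≡ x ⊎ v ≡ y ⊎ Edge G x v ⊎ Edge G y v
  dominated-by-pair dominating v with dominating v
  ... | u , u∈ , u-v with pair-elements u u∈ | u-v
  ...   | inj₁ refl | inj₁ refl = inj₁ refl
  ...   | inj₂ refl | inj₁ refl = inj₂ (inj₁ refl)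
  ...   | inj₁ refl | inj₂ x~v  = inj₂ (inj₂ (inj₁ x~v))
  ...   | inj₂ refl | inj₂ y~v  = inj₂ (inj₂ (inj₂ y~v))

-- The hypotheses yield the configuration; of the minimal connected dominating
-- set only domination and connectivity are needed, and of F only four graphs.
configuration : (G : Graph) → FFree G → (x y : V G) → x ≢ y
  → MinimalConnectedDominating G (pair G x y) → (x' y' : V G)
  → PrivateNeighbor G (pair G x y) x x' → PrivateNeighbor G (pair G x y) y y'
  → Edge G x' y' → Configuration G
configuration G (_ , _ , _ , no-banner , no-house , no-K23 , no-co-P₂∪P₃)
  x y x≢y ((dominating , connected) , _) x' y' x'-private y'-private x'~y' = record
  { x = x ; y = y ; x' = x' ; y' = y'
  ; x~y   = x~y
  ; x~x'  = private-adjacent G x'-private y∈D∖x (adj-sym G x~y)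
  ; y~y'  = private-adjacent G y'-private x∈D∖y x~y
  ; x'~y' = x'~y'
  ; y≁x'  = private-non-adjacent G x'-private y∈D∖x
  ; x≁y'  = private-non-adjacent G y'-private x∈D∖y
  ; x'≢y  = private-distinct G x'-private y∈D∖x
  ; y'≢x  = private-distinct G y'-private x∈D∖y
  ; dominated = dominated-by-pair G x y x≢y dominating
  ; no-banner = no-banner ; no-house = no-house ; no-K23 = no-K23 ; no-co-P₂∪P₃ = no-co-P₂∪P₃
  }
  where
  x~y : Edge G x y
  x~y = connected-pair-adjacent G x y x≢y connected
  y∈D∖x : remove G (pair G x y) x y ≡ true
  y∈D∖x = y∈pair-x G x y x≢y
  x∈D∖y : remove G (pair G x y) y x ≡ true
  x∈D∖y = x∈pair-y G x y x≢y

-- Lemma 8.5: by (3) and the absence of universal vertices G ≅ K_{2n} − ne, and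
-- the distinct vertices x, y, x' force n ≥ 2.
lemma8p5 : (G : Graph) → Connected G → FFree G
    → (∀ v → ¬ Universal G v)
    → (x y : V G) → x ≢ y
    → MinimalConnectedDominating G (pair G x y)
    → (x' y' : V G)
    → PrivateNeighbor G (pair G x y) x x'
    → PrivateNeighbor G (pair G x y) y y'
    → Edge G x' y'
    → Σ ℕ λ n → 2 ≤ n × IsoTo G (KminusMatching n)
lemma8p5 G _ free no-universal x y x≢y minimal x' y' x'-private y'-private x'~y' =
  three-vertices⇒2≤n x y x' x≢y (adjacent⇒distinct G x~x') (≢-sym x'≢y)
    (co-matching G no-universal (at-most-one-non-neighbour C))
  where
  C : Configuration G
  C = configuration G free x y x≢y minimal x' y' x'-private y'-private x'~y'
  open Configuration C using (x~x'; x'≢y)
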